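{- Let $(L,\le)$ be a finite lattice and $\mathcal R$ a transfer system on $L$. The map $\Phi:\mathcal R^c_M\to\operatorname{Cov}_{\downarrow}(\mathcal R)$, $(a,b)\mapsto\mathcal R_{(a,b)}$, is well defined and is a bijection.
   Context: Write $\operatorname{Rel}(L)=\{(a,b)\in L^2: a\le b\}$. A transfer system on $L$ is a partial order $\lhd$ on $L$ (identified with its set of pairs) such that $i\lhd j$ implies $i\le j$, and $i\lhd k$, $j\le k$ imply $(i\wedge j)\lhd j$; $\operatorname{Trs}(L)$ is the set of transfer systems ordered by inclusion. $\operatorname{Cov}_{\downarrow}(\mathcal R)$ is the set of transfer systems covered by $\mathcal R$ in $\operatorname{Trs}(L)$. $\mathcal R^c$ is the set of cover relations of the poset $(L,\mathcal R)$. For $(a,b),(u,v)\in\operatorname{Rel}(L)$, $(a,b)\sqsubset(u,v)$ means $b\le v$, $a\le u$ and $a=b\wedge u$ (a reflexive partial order). $\mathcal R^c_M$ is the set of maximal elements of $(\mathcal R^c,\sqsubset)$. For $(a,b)\in\mathcal R^c$, $\mathcal R_{(a,b)}=\mathcal R\setminus\{(u,v)\in\mathcal R: u\ne v,\ (a,b)\sqsubset(u,v)\}$. -}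

module Defs where

open import Level using (0ℓ)
open import Data.Nat using (ℕ)
open import Data.Fin using (Fin)
import Data.Fin.Properties as FinP
open import Data.Bool using (Bool; true; false; _∧_; not)
open import Data.Product using (_×_; _,_; ∃; ∃-syntax)
open import Data.Empty using (⊥)
open import Function.Bundles using (_↔_; Inverse)
open import Relation.Nullary using (¬_; Dec; yes; no)
open import Relation.Nullary.Decidable using (map′; ⌊_⌋; _×-dec_; ¬?)
open import Relation.Binary using (Rel; Decidable; IsPartialOrder)
open import Relation.Binary.Lattice.Structures using (IsLattice)
open import Algebra.Core using (Op₂)
open import Relation.Binary.PropositionalEquality using (_≡_; refl; sym; trans; cong)

record FiniteLattice : Set₁ where
  field
    Carrier   : Set
    _≤_       : Rel Carrier 0ℓ
    _⊔_       : Op₂ Carrier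
    _⊓_       : Op₂ Carrier
    isLattice : IsLattice _≡_ _≤_ _⊔_ _⊓_
    _≤?_      : Decidable _≤_
    size      : ℕ
    enum      : Fin size ↔ Carrier

module FL (𝕃 : FiniteLattice) where
  open FiniteLattice 𝕃 public

  _≟_ : Decidable {A = Carrier} _≡_
  x ≟ y = map′ inj (cong from) (FinP._≟_ (from x) (from y))
    where
    open Inverse enum
    tf : ∀ z → to (from z) ≡ z
    tf z = inverseˡ refl
    inj : from x ≡ from y → x ≡ y
    inj e = trans (sym (tf x)) (trans (cong to e) (tf y))

  -- a subset of L × L (i.e. a binary relation on L), as a decidable predicate
  BRel : Set
  BRel = Carrier → Carrier → Bool

  ⟦_⟧ : BRel → Carrier → Carrier → Set
  ⟦ R ⟧ a b = R a b ≡ true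

  _⊆_ : BRel → BRel → Set
  R ⊆ S = ∀ {a b} → ⟦ R ⟧ a b → ⟦ S ⟧ a b

  _⊂_ : BRel → BRel → Set
  R ⊂ S = (R ⊆ S) × ¬ (S ⊆ R)

  _≐_ : BRel → BRel → Set
  R ≐ S = ∀ a b → R a b ≡ S a b

  record IsTransferSystem (R : BRel) : Set where
    field
      partialOrder : IsPartialOrder _≡_ ⟦ R ⟧
      refines      : ∀ {i j} → ⟦ R ⟧ i j → i ≤ j
      restriction  : ∀ {i j k} → ⟦ R ⟧ i k → j ≤ k → ⟦ R ⟧ (i ⊓ j) j

  CoveredBy : BRel → BRel → Set
  CoveredBy T R =
    IsTransferSystem T × T ⊂ R ×
    ¬ (∃[ S ] (IsTransferSystem S × T ⊂ S × S ⊂ R))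

  IsCover : BRel → Carrier → Carrier → Set
  IsCover R a b =
    ⟦ R ⟧ a b × ¬ (a ≡ b) ×
    ¬ (∃[ c ] (⟦ R ⟧ a c × ¬ (a ≡ c) × ⟦ R ⟧ c b × ¬ (c ≡ b)))

  _⊑_ : Carrier × Carrier → Carrier × Carrier → Set
  (a , b) ⊑ (u , v) = (b ≤ v) × (a ≤ u) × (a ≡ b ⊓ u)

  _⊑?_ : ∀ p q → Dec (p ⊑ q)
  (a , b) ⊑? (u , v) = (b ≤? v) ×-dec ((a ≤? u) ×-dec (a ≟ (b ⊓ u)))

  IsMaxCover : BRel → Carrier → Carrier → Set
  IsMaxCover R a b =
    IsCover R a b ×
    (∀ u v → IsCover R u v → (a , b) ⊑ (u , v) → (u , v) ≡ (a , b))

  -- R_(a,b) = R \ {(u , v) ∈ R : u ≠ v , (a , b) ⊑ (u , v)}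
  Rdel : BRel → Carrier → Carrier → BRel
  Rdel R a b u v =
    R u v ∧ not (⌊ ¬? (u ≟ v) ×-dec ((a , b) ⊑? (u , v)) ⌋)

{-# OPTIONS --safe #-}
module Submission where

-- For a cover (a , b) of R, R_(a,b) is again a transfer system: restricting a
-- kept pair gives a kept pair, and a removed composite of kept pairs would
-- produce an element strictly between a and b. By restriction, a transfer
-- system S ⊆ R that misses (a , b) misses everything ⊑-above it, so
-- S ⊆ R_(a,b). A finite poset is generated by its covers, hence a transfer
-- system strictly below R misses some cover (a , b), and for T ∈ Cov↓(R) this
-- forces T = R_(a,b). Maximality of that (a , b), and injectivity of Φ, both
-- come from (a , b) ∉ R_(a,b) = R_(a′,b′), which says (a′ , b′) ⊑ (a , b).

open import Defs
open import Level using (0ℓ)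
open import Data.Bool using (Bool; true; false; _∧_; not)
import Data.Bool as Bool
open import Data.Bool.Properties using (⇔→≡)
open import Data.Empty using (⊥-elim)
open import Data.Fin using (Fin)
open import Data.Fin.Properties using (any?)
import Data.Fin.Induction as FinInduction
open import Data.Nat using (ℕ)
open import Data.Product using (_×_; _,_; ∃; ∃-syntax; proj₁; proj₂; uncurry)
open import Data.Product.Properties using (,-injective)
open import Data.Sum using (_⊎_; inj₁; inj₂)
open import Function using (_∘_; flip; _on_)
open import Function.Bundles using (_↔_; Inverse; _⇔_; mk⇔; Equivalence)
open import Induction.WellFounded using (WellFounded; Acc; acc)
open import Relation.Nullary using (¬_; Dec; yes; no; contradiction)
open import Relation.Nullary.Decidable using (⌊_⌋; map′; _×-dec_; ¬?; decidable-stable)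
open import Relation.Unary using (Pred)
import Relation.Unary as Unary
open import Relation.Binary using (Rel; Reflexive; Transitive; IsPartialOrder; IsStrictPartialOrder)
open import Relation.Binary.Lattice.Bundles using (MeetSemilattice)
open import Relation.Binary.Lattice.Structures using (IsLattice)
import Relation.Binary.Lattice.Properties.MeetSemilattice as MeetSemilatticeProperties
import Relation.Binary.Construct.On as On
import Relation.Binary.Construct.Flip.EqAndOrd as Flip
import Relation.Binary.Construct.NonStrictToStrict as ToStrict
open import Relation.Binary.PropositionalEquality
  using (_≡_; refl; sym; trans; cong; cong₂; subst; isEquivalence; module ≡-Reasoning)

module Finite {A : Set} {n : ℕ} (enum : Fin n ↔ A) where
  open Inverse enum using (to; from; strictlyInverseˡ)

  ∃? : ∀ {p} {P : Pred A p} → Unary.Decidable P → Dec (∃ P)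
  ∃? {P = P} P? =
    map′ (λ (i , p) → to i , p)
         (λ (x , p) → from x , subst P (sym (strictlyInverseˡ x)) p)
         (any? (P? ∘ to))

  spo-wellFounded : ∀ {ℓ r} {_≈_ : Rel A ℓ} {_<_ : Rel A r} →
                    IsStrictPartialOrder _≈_ _<_ → WellFounded _<_
  spo-wellFounded {_<_ = _<_} spo x =
    subst (Acc _<_) (strictlyInverseˡ x)
      (acc-to (FinInduction.spo-wellFounded (On.isStrictPartialOrder to spo) (from x)))
    where
    acc-to : ∀ {i} → Acc (_<_ on to) i → Acc _<_ (to i)
    acc-to {i} (acc below) = acc λ {y} y<to-i →
      subst (Acc _<_) (strictlyInverseˡ y)
        (acc-to (below (subst (_< to i) (sym (strictlyInverseˡ y)) y<to-i)))

∧-not-⌊⌋≡true : ∀ {p} {P : Set p} (r : Bool) (P? : Dec P) →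
                r ∧ not ⌊ P? ⌋ ≡ true ⇔ (r ≡ true × ¬ P)
∧-not-⌊⌋≡true true  (yes p) = mk⇔ (λ ()) (λ (_ , ¬p) → contradiction p ¬p)
∧-not-⌊⌋≡true true  (no ¬p) = mk⇔ (λ _ → refl , ¬p) (λ _ → refl)
∧-not-⌊⌋≡true false _       = mk⇔ (λ ()) (λ { (() , _) })

module TransferSystems (𝕃 : FiniteLattice) where
  open FL 𝕃
  open Finite enum
  open IsLattice isLattice using (antisym)
    renaming (x∧y≤x to x⊓y≤x; x∧y≤y to x⊓y≤y; refl to ≤-refl; trans to ≤-trans)

  meetSemilattice : MeetSemilattice 0ℓ 0ℓ 0ℓ
  meetSemilattice = record { isMeetSemilattice = IsLattice.isMeetSemilattice isLattice }

  open MeetSemilatticeProperties meetSemilattice using ()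
    renaming (∧-comm to ⊓-comm; ∧-assoc to ⊓-assoc; y≤x⇒x∧y≈y to y≤x⇒x⊓y≡y)

  x≤y⇒x⊓y≡x : ∀ {x y} → x ≤ y → x ⊓ y ≡ x
  x≤y⇒x⊓y≡x {x} {y} x≤y = trans (⊓-comm x y) (y≤x⇒x⊓y≡y x≤y)

  x⊓y≡y⇒y≤x : ∀ {x y} → x ⊓ y ≡ y → y ≤ x
  x⊓y≡y⇒y≤x {x} {y} e = subst (_≤ x) e (x⊓y≤x x y)

  x≤y⇒x⊓[y⊓z]≡x⊓z : ∀ {x y} z → x ≤ y → x ⊓ (y ⊓ z) ≡ x ⊓ z
  x≤y⇒x⊓[y⊓z]≡x⊓z {x} {y} z x≤y = begin
    x ⊓ (y ⊓ z) ≡⟨ sym (⊓-assoc x y z) ⟩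
    (x ⊓ y) ⊓ z ≡⟨ cong (_⊓ z) (x≤y⇒x⊓y≡x x≤y) ⟩
    x ⊓ z       ∎
    where open ≡-Reasoning

  ⊑-intro : ∀ {a b u v} → b ≤ v → a ≡ b ⊓ u → (a , b) ⊑ (u , v)
  ⊑-intro {b = b} {u} b≤v a≡b⊓u = b≤v , subst (_≤ u) (sym a≡b⊓u) (x⊓y≤y b u) , a≡b⊓u

  ⊑-refl : ∀ {a b} → a ≤ b → (a , b) ⊑ (a , b)
  ⊑-refl {a} {b} a≤b = ⊑-intro ≤-refl (sym (y≤x⇒x⊓y≡y a≤b))

  ⊑-antisym : ∀ {a b u v} → (u , v) ⊑ (a , b) → (a , b) ⊑ (u , v) → (u , v) ≡ (a , b)
  ⊑-antisym (v≤b , u≤a , _) (b≤v , a≤u , _) = cong₂ _,_ (antisym u≤a a≤u) (antisym v≤b b≤v)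

  ∈? : ∀ R u v → Dec (⟦ R ⟧ u v)
  ∈? R u v = R u v Bool.≟ true

  ⊆-antisym : ∀ {R S} → R ⊆ S → S ⊆ R → R ≐ S
  ⊆-antisym R⊆S S⊆R u v = ⇔→≡ (mk⇔ R⊆S S⊆R)

  ⊈-witness : ∀ {R S} → ¬ (R ⊆ S) → ∃[ u ] ∃[ v ] (⟦ R ⟧ u v × ¬ ⟦ S ⟧ u v)
  ⊈-witness {R} {S} R⊈S with ∃? (λ u → ∃? λ v → ∈? R u v ×-dec ¬? (∈? S u v))
  ... | yes witness = witness
  ... | no none = contradiction
    (λ {u} {v} uv∈R → decidable-stable (∈? S u v) λ uv∉S → none (u , v , uv∈R , uv∉S)) R⊈S

  cover-between : ∀ {R a b c} → IsCover R a b → ⟦ R ⟧ a c → ⟦ R ⟧ c b → a ≡ c ⊎ c ≡ b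
  cover-between {a = a} {b} {c} (_ , _ , nothing-between) ac∈R cb∈R with a ≟ c | c ≟ b
  ... | yes a≡c | _       = inj₁ a≡c
  ... | no _    | yes c≡b = inj₂ c≡b
  ... | no a≢c  | no c≢b  = ⊥-elim (nothing-between (c , ac∈R , a≢c , cb∈R , c≢b))

  module _ {R : BRel} (R-po : IsPartialOrder _≡_ ⟦ R ⟧) where
    private
      _<_ : Rel Carrier 0ℓ
      _<_ = ToStrict._<_ _≡_ ⟦ R ⟧

      <-isStrictPartialOrder : IsStrictPartialOrder _≡_ _<_
      <-isStrictPartialOrder = ToStrict.<-isStrictPartialOrder _≡_ ⟦ R ⟧ R-po

      <-wellFounded : WellFounded _<_
      <-wellFounded = spo-wellFounded <-isStrictPartialOrder

      >-wellFounded : WellFounded (flip _<_)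
      >-wellFounded = spo-wellFounded (Flip.isStrictPartialOrder <-isStrictPartialOrder)

    -- Split (u , v) at an element strictly between u and v; one half is still
    -- outside S. Recursion is lexicographic: the upper end descends, or it stays
    -- and the lower end ascends.
    cover-outside : ∀ {S} → Reflexive ⟦ S ⟧ → Transitive ⟦ S ⟧ →
                    ∀ {u v} → ⟦ R ⟧ u v → ¬ ⟦ S ⟧ u v →
                    ∃[ c ] ∃[ d ] (IsCover R c d × ¬ ⟦ S ⟧ c d)
    cover-outside {S} S-refl S-trans {u} {v} = descend (<-wellFounded v) (>-wellFounded u)
      where
      descend : ∀ {u v} → Acc _<_ v → Acc (flip _<_) u → ⟦ R ⟧ u v → ¬ ⟦ S ⟧ u v →
                ∃[ c ] ∃[ d ] (IsCover R c d × ¬ ⟦ S ⟧ c d)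
      descend {u} {v} acc-v acc-u uv∈R uv∉S
        with ∃? (λ c → ∈? R u c ×-dec ¬? (u ≟ c) ×-dec ∈? R c v ×-dec ¬? (c ≟ v))
      ... | no nothing-between =
        u , v , (uv∈R , (λ { refl → uv∉S S-refl }) , nothing-between) , uv∉S
      ... | yes (c , uc∈R , u≢c , cv∈R , c≢v) with ∈? S u c
      descend (acc below-v) _ _ _ | yes (c , uc∈R , u≢c , cv∈R , c≢v) | no uc∉S =
        descend (below-v (cv∈R , c≢v)) (>-wellFounded _) uc∈R uc∉S
      descend acc-v (acc above-u) _ uv∉S | yes (c , uc∈R , u≢c , cv∈R , c≢v) | yes uc∈S =
        descend acc-v (above-u (uc∈R , u≢c)) cv∈R (λ cv∈S → uv∉S (S-trans uc∈S cv∈S))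

    ⊈⇒cover∉ : ∀ {S} → Reflexive ⟦ S ⟧ → Transitive ⟦ S ⟧ → ¬ (R ⊆ S) →
               ∃[ c ] ∃[ d ] (IsCover R c d × ¬ ⟦ S ⟧ c d)
    ⊈⇒cover∉ S-refl S-trans R⊈S with ⊈-witness R⊈S
    ... | u , v , uv∈R , uv∉S = cover-outside S-refl S-trans uv∈R uv∉S

  module TS {R : BRel} (R-ts : IsTransferSystem R) =
    IsPartialOrder (IsTransferSystem.partialOrder R-ts)

  Removed : Carrier → Carrier → Carrier → Carrier → Set
  Removed a b u v = ¬ u ≡ v × (a , b) ⊑ (u , v)

  Removed? : ∀ a b u v → Dec (Removed a b u v)
  Removed? a b u v = ¬? (u ≟ v) ×-dec ((a , b) ⊑? (u , v))

  module Deletion (R : BRel) {a b : Carrier} where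
    ∈Rdel⇔ : ∀ {u v} → ⟦ Rdel R a b ⟧ u v ⇔ (⟦ R ⟧ u v × ¬ Removed a b u v)
    ∈Rdel⇔ {u} {v} = ∧-not-⌊⌋≡true (R u v) (Removed? a b u v)

    ∈Rdel⁺ : ∀ {u v} → ⟦ R ⟧ u v → ¬ Removed a b u v → ⟦ Rdel R a b ⟧ u v
    ∈Rdel⁺ uv∈R uv-kept = Equivalence.from ∈Rdel⇔ (uv∈R , uv-kept)

    ∈Rdel⁻ : ∀ {u v} → ⟦ Rdel R a b ⟧ u v → ⟦ R ⟧ u v × ¬ Removed a b u v
    ∈Rdel⁻ = Equivalence.to ∈Rdel⇔

    Rdel⊆ : Rdel R a b ⊆ R
    Rdel⊆ = proj₁ ∘ ∈Rdel⁻

    ∉Rdel⇒Removed : ∀ {u v} → ⟦ R ⟧ u v → ¬ ⟦ Rdel R a b ⟧ u v → Removed a b u v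
    ∉Rdel⇒Removed {u} {v} uv∈R uv∉Rdel =
      decidable-stable (Removed? a b u v) (λ uv-kept → uv∉Rdel (∈Rdel⁺ uv∈R uv-kept))

  ⊑-closed : ∀ {S a b u v} → IsTransferSystem S → ⟦ S ⟧ u v → (a , b) ⊑ (u , v) → ⟦ S ⟧ a b
  ⊑-closed {S} {a} {b} {u} S-ts uv∈S (b≤v , _ , a≡b⊓u) =
    subst (λ x → ⟦ S ⟧ x b) (trans (⊓-comm u b) (sym a≡b⊓u))
      (IsTransferSystem.restriction S-ts uv∈S b≤v)

  ⊆Rdel : ∀ {S R a b} → IsTransferSystem S → S ⊆ R → ¬ ⟦ S ⟧ a b → S ⊆ Rdel R a b
  ⊆Rdel {R = R} S-ts S⊆R ab∉S uv∈S =
    Deletion.∈Rdel⁺ R (S⊆R uv∈S) λ (_ , ab⊑uv) → ab∉S (⊑-closed S-ts uv∈S ab⊑uv)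

  coveredBy⇒maximal : ∀ {T U R} → CoveredBy T R → IsTransferSystem U → T ⊆ U → U ⊂ R → U ⊆ T
  coveredBy⇒maximal {T} (_ , _ , nothing-between) U-ts T⊆U U⊂R {u} {v} uv∈U with ∈? T u v
  ... | yes uv∈T = uv∈T
  ... | no uv∉T = ⊥-elim (nothing-between (_ , U-ts , (T⊆U , λ U⊆T → uv∉T (U⊆T uv∈U)) , U⊂R))

  module _ {R : BRel} (R-ts : IsTransferSystem R) where
    open IsTransferSystem R-ts using (partialOrder; refines; restriction)
    private module R = TS R-ts
    open Deletion R

    module _ {a b} (ab-cover : IsCover R a b) where
      private
        ab∈R = proj₁ ab-cover
        a≢b  = proj₁ (proj₂ ab-cover)

      Rdel-refl : Reflexive ⟦ Rdel R a b ⟧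
      Rdel-refl = ∈Rdel⁺ R.refl λ (x≢x , _) → x≢x refl

      -- If (x , z) were removed, y ⊓ b would lie between a and b in R; both
      -- possible collapses force (x , y) or (y , z) to have been removed.
      Rdel-trans : Transitive ⟦ Rdel R a b ⟧
      Rdel-trans {x} {y} {z} xy∈Rdel yz∈Rdel with ∈Rdel⁻ xy∈Rdel | ∈Rdel⁻ yz∈Rdel
      ... | xy∈R , xy-kept | yz∈R , yz-kept = ∈Rdel⁺ (R.trans xy∈R yz∈R) xz-kept
        where
        xz-kept : ¬ Removed a b x z
        xz-kept (x≢z , b≤z , _ , a≡b⊓x) with cover-between ab-cover a[y⊓b]∈R [y⊓b]b∈R
          where
          [y⊓b]b∈R : ⟦ R ⟧ (y ⊓ b) b
          [y⊓b]b∈R = restriction yz∈R b≤z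
          a[y⊓b]∈R : ⟦ R ⟧ a (y ⊓ b)
          a[y⊓b]∈R = subst (λ w → ⟦ R ⟧ w (y ⊓ b))
            (trans (x≤y⇒x⊓[y⊓z]≡x⊓z b (refines xy∈R)) (trans (⊓-comm x b) (sym a≡b⊓x)))
            (restriction xy∈R (x⊓y≤x y b))
        ... | inj₁ a≡y⊓b with y ≟ z
        ...   | yes refl = xy-kept (x≢z , ⊑-intro b≤z a≡b⊓x)
        ...   | no y≢z   = yz-kept (y≢z , ⊑-intro b≤z (trans a≡y⊓b (⊓-comm y b)))
        xz-kept (x≢z , b≤z , _ , a≡b⊓x) | inj₂ y⊓b≡b =
          xy-kept (x≢y , ⊑-intro (x⊓y≡y⇒y≤x y⊓b≡b) a≡b⊓x)
          where
          x≢y : ¬ x ≡ y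
          x≢y refl = a≢b (trans a≡b⊓x (x≤y⇒x⊓y≡x (x⊓y≡y⇒y≤x y⊓b≡b)))

      Rdel-restriction : ∀ {i j k} → ⟦ Rdel R a b ⟧ i k → j ≤ k → ⟦ Rdel R a b ⟧ (i ⊓ j) j
      Rdel-restriction {i} {j} {k} ik∈Rdel j≤k with ∈Rdel⁻ ik∈Rdel
      ... | ik∈R , ik-kept = ∈Rdel⁺ (restriction ik∈R j≤k) [i⊓j]j-kept
        where
        [i⊓j]j-kept : ¬ Removed a b (i ⊓ j) j
        [i⊓j]j-kept (i⊓j≢j , b≤j , _ , a≡b⊓[i⊓j]) =
          ik-kept ((λ { refl → i⊓j≢j (y≤x⇒x⊓y≡y j≤k) }) , ⊑-intro (≤-trans b≤j j≤k) a≡b⊓i)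
          where
          a≡b⊓i : a ≡ b ⊓ i
          a≡b⊓i = trans a≡b⊓[i⊓j] (trans (cong (b ⊓_) (⊓-comm i j)) (x≤y⇒x⊓[y⊓z]≡x⊓z i b≤j))

      Rdel-isTransferSystem : IsTransferSystem (Rdel R a b)
      Rdel-isTransferSystem = record
        { partialOrder = record
          { isPreorder = record
            { isEquivalence = isEquivalence
            ; reflexive     = λ { refl → Rdel-refl }
            ; trans         = Rdel-trans
            }
          ; antisym = λ p q → R.antisym (Rdel⊆ p) (Rdel⊆ q)
          }
        ; refines     = refines ∘ Rdel⊆
        ; restriction = Rdel-restriction
        }

      cover∉Rdel : ¬ ⟦ Rdel R a b ⟧ a b
      cover∉Rdel ab∈Rdel = proj₂ (∈Rdel⁻ ab∈Rdel) (a≢b , ⊑-refl (refines ab∈R))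

      Rdel-⊂ : Rdel R a b ⊂ R
      Rdel-⊂ = Rdel⊆ , λ R⊆Rdel → cover∉Rdel (R⊆Rdel ab∈R)

      Rdel-≐⇒⊑ : ∀ {a′ b′} → Rdel R a b ≐ Rdel R a′ b′ → (a′ , b′) ⊑ (a , b)
      Rdel-≐⇒⊑ eq = proj₂ (∉Rdel⇒Removed ab∈R (λ ab∈Rdel′ → cover∉Rdel (trans (eq a b) ab∈Rdel′)))

    Rdel-coveredBy : ∀ {a b} → IsMaxCover R a b → CoveredBy (Rdel R a b) R
    Rdel-coveredBy {a} {b} (ab-cover , ab-maximal) =
      Rdel-isTransferSystem ab-cover , Rdel-⊂ ab-cover , nothing-between
      where
      nothing-between : ¬ (∃[ S ] (IsTransferSystem S × Rdel R a b ⊂ S × S ⊂ R))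
      nothing-between (S , S-ts , (Rdel⊆S , S⊈Rdel) , (S⊆R , R⊈S)) with ∈? S a b
      ... | no ab∉S = S⊈Rdel (⊆Rdel S-ts S⊆R ab∉S)
      ... | yes ab∈S with ⊈⇒cover∉ partialOrder (TS.refl S-ts) (TS.trans S-ts) R⊈S
      ...   | c , d , cd-cover , cd∉S = cd∉S (subst (uncurry ⟦ S ⟧) (sym cd≡ab) ab∈S)
        where
        cd≡ab : (c , d) ≡ (a , b)
        cd≡ab = ab-maximal c d cd-cover
                  (proj₂ (∉Rdel⇒Removed (proj₁ cd-cover) (cd∉S ∘ Rdel⊆S)))

    Rdel-injective : ∀ {a b a′ b′} → IsMaxCover R a b → IsMaxCover R a′ b′ →
                     Rdel R a b ≐ Rdel R a′ b′ → (a , b) ≡ (a′ , b′)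
    Rdel-injective (ab-cover , _) (_ , a′b′-maximal) eq =
      a′b′-maximal _ _ ab-cover (Rdel-≐⇒⊑ ab-cover eq)

    coveredBy⇒Rdel≐ : ∀ {T a b} → CoveredBy T R → IsCover R a b → ¬ ⟦ T ⟧ a b → Rdel R a b ≐ T
    coveredBy⇒Rdel≐ {T} {a} {b} T-covered@(T-ts , (T⊆R , _) , _) ab-cover ab∉T =
      ⊆-antisym
        (coveredBy⇒maximal T-covered (Rdel-isTransferSystem ab-cover) T⊆Rdel (Rdel-⊂ ab-cover))
        T⊆Rdel
      where
      T⊆Rdel : T ⊆ Rdel R a b
      T⊆Rdel = ⊆Rdel T-ts T⊆R ab∉T

    coveredBy⇒Rdel : ∀ {T} → CoveredBy T R → ∃[ a ] ∃[ b ] (IsMaxCover R a b × Rdel R a b ≐ T)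
    coveredBy⇒Rdel {T} T-covered@(T-ts , (_ , R⊈T) , _)
      with ⊈⇒cover∉ partialOrder (TS.refl T-ts) (TS.trans T-ts) R⊈T
    ... | a , b , ab-cover , ab∉T = a , b , (ab-cover , ab-maximal) , Rdel≐T
      where
      Rdel≐T : Rdel R a b ≐ T
      Rdel≐T = coveredBy⇒Rdel≐ T-covered ab-cover ab∉T

      ab-maximal : ∀ u v → IsCover R u v → (a , b) ⊑ (u , v) → (u , v) ≡ (a , b)
      ab-maximal u v uv-cover ab⊑uv =
        ⊑-antisym (Rdel-≐⇒⊑ ab-cover λ x y → trans (Rdel≐T x y) (sym (Rdel[uv]≐T x y))) ab⊑uv
        where
        uv∉T : ¬ ⟦ T ⟧ u v
        uv∉T uv∈T = proj₂ (∈Rdel⁻ (trans (Rdel≐T u v) uv∈T)) (proj₁ (proj₂ uv-cover) , ab⊑uv)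
        Rdel[uv]≐T : Rdel R u v ≐ T
        Rdel[uv]≐T = coveredBy⇒Rdel≐ T-covered uv-cover uv∉T

mainTheorem19 : (𝕃 : FiniteLattice) → let open FL 𝕃 in
    (R : BRel) → IsTransferSystem R →
    -- well defined: Φ(a , b) = R_(a,b) lies in Cov↓(R)
    (∀ a b → IsMaxCover R a b → CoveredBy (Rdel R a b) R)
    -- injective
    × (∀ a b a′ b′ → IsMaxCover R a b → IsMaxCover R a′ b′ →
         Rdel R a b ≐ Rdel R a′ b′ → (a ≡ a′) × (b ≡ b′))
    -- surjective
    × (∀ T → CoveredBy T R → ∃[ a ] ∃[ b ] (IsMaxCover R a b × Rdel R a b ≐ T))
mainTheorem19 𝕃 R R-ts =
    (λ _ _ → Rdel-coveredBy R-ts)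
  , (λ _ _ _ _ ab-max a′b′-max eq → ,-injective (Rdel-injective R-ts ab-max a′b′-max eq))
  , (λ _ → coveredBy⇒Rdel R-ts)
  where open TransferSystems 𝕃
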